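{- Consider the online facility assignment problem on an equilateral triangle with side length $S$, with three facilities at the three vertices, each of capacity $2$, and at most $6$ customers appearing one at a time on the boundary of the triangle. The competitive ratio of the greedy algorithm is at least $5$.
   Context: Online facility assignment: customers arrive sequentially at points on the boundary and must each be assigned irrevocably on arrival to a facility with remaining capacity; the cost of assigning a customer to a facility is their distance (measured along the boundary), and the total cost is the sum of assignment costs. The greedy algorithm assigns each arriving customer to the nearest facility that still has remaining capacity. The competitive ratio of the greedy algorithm is the supremum, over input sequences $I$, of $\mathrm{Cost}_{Greedy}(I)/\mathrm{Cost}_{OPT}(I)$, where $\mathrm{Cost}_{OPT}(I)$ is the minimum total cost of a capacity-respecting assignment computed with full knowledge of $I$.
   Formalization: The side length $S$ of the triangle is rational, and the positions of the customers on the boundary are taken in the rationals. -}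

module Defs where

open import Data.Nat as ℕ using (ℕ; zero; suc)
open import Data.Fin using (Fin; toℕ)
open import Data.Fin.Properties using (_≟_)
open import Data.List using (List; []; _∷_; length; filter; zipWith; foldr)
open import Data.List.Relation.Unary.All using (All)
open import Data.Product using (Σ; ∃; _×_; _,_)
open import Data.Rational using (ℚ; 0ℚ; _+_; _-_; _*_; _⊓_; ∣_∣; _≤_; _<_)
open import Data.Rational using () renaming (_/_ to _÷_)
open import Data.Integer using (+_)
open import Relation.Binary.PropositionalEquality using (_≡_; _≢_)
open import Relation.Nullary using (does)
open import Data.Bool using (if_then_else_)

-- The boundary of the equilateral triangle with side S is parametrised by
-- arc length t ∈ [0, 3S), starting at vertex 0 and going around.
-- Facility i (i = 0,1,2) sits at the vertex with coordinate i·S.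

fromℕ : ℕ → ℚ
fromℕ n = (+ n) ÷ 1

perim : ℚ → ℚ
perim S = fromℕ 3 * S

OnBoundary : ℚ → ℚ → Set
OnBoundary S t = (0ℚ ≤ t) × (t < perim S)

dist : ℚ → ℚ → ℚ → ℚ
dist S x y = ∣ x - y ∣ ⊓ (perim S - ∣ x - y ∣)

facPos : ℚ → Fin 3 → ℚ
facPos S i = fromℕ (toℕ i) * S

capacity : ℕ
capacity = 2

maxCustomers : ℕ
maxCustomers = 6

ValidInput : ℚ → List ℚ → Set
ValidInput S I = (length I ℕ.≤ maxCustomers) × All (OnBoundary S) I

-- an assignment lists, for each customer in order, the chosen facility
load : List (Fin 3) → Fin 3 → ℕ
load a i = length (filter (λ j → j ≟ i) a)

Feasible : List ℚ → List (Fin 3) → Set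
Feasible I a = (length a ≡ length I) × (∀ i → load a i ℕ.≤ capacity)

sumℚ : List ℚ → ℚ
sumℚ = foldr _+_ 0ℚ

cost : ℚ → List ℚ → List (Fin 3) → ℚ
cost S I a = sumℚ (zipWith (λ x i → dist S x (facPos S i)) I a)

IsOptCost : ℚ → List ℚ → ℚ → Set
IsOptCost S I c =
  (Σ (List (Fin 3)) λ a → Feasible I a × cost S I a ≡ c)
  × (∀ b → Feasible I b → c ≤ cost S I b)

Loads : Set
Loads = Fin 3 → ℕ

bump : Loads → Fin 3 → Loads
bump ld i j = if does (j ≟ i) then suc (ld j) else ld j

data GreedyFrom (S : ℚ) : Loads → List ℚ → List (Fin 3) → Set where
  done : ∀ {ld} → GreedyFrom S ld [] []
  step : ∀ {ld x xs i as} →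
         ld i ℕ.< capacity →
         (∀ j → ld j ℕ.< capacity → dist S x (facPos S i) ≤ dist S x (facPos S j)) →
         GreedyFrom S (bump ld i) xs as →
         GreedyFrom S ld (x ∷ xs) (i ∷ as)

GreedyRun : ℚ → List ℚ → List (Fin 3) → Set
GreedyRun S I a = GreedyFrom S (λ _ → 0) I a

-- Write the side as S = D + 24η with D ≥ 0 and η > 0 small.  Customers arrive
-- at S/2 − η (just nearer vertex 0 than vertex 1), at vertex 0, at 3S − η (just
-- before vertex 0, coming from vertex 2), twice at vertex 2, and at vertex 1.
-- Greedy fills vertex 0 with the first two, so the third travels S − η to vertex 2,
-- which in turn pushes the second vertex-2 customer a full side to vertex 1:
-- greedy pays 5S/2 − 2η, while serving the first customer at vertex 1 and the
-- third at vertex 0 costs only S/2 + 2η.  As η → 0 the ratio tends to 5.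
--
-- Every position and distance is a linear form aD + bη; they are compared
-- coefficientwise, so all the case analysis is decided by computation.
module Submission where

open import Defs
open import Data.Empty using (⊥-elim)
open import Data.Fin using (Fin; zero; suc; toℕ)
open import Data.Fin.Properties using (_≟_) renaming (all? to allFin?)
open import Data.Integer using (+_)
open import Data.List using (List; []; _∷_; _++_; length; map)
open import Data.List.Relation.Unary.All as All using (All; []; _∷_)
open import Data.List.Relation.Unary.All.Properties using (map⁺)
open import Data.Nat as ℕ using (s≤s)
open import Data.Nat.Properties as ℕ using ()
open import Data.Product using (Σ; _×_; _,_)
open import Data.Rational
  using (ℚ; 0ℚ; 1ℚ; _+_; _-_; _*_; -_; _/_; ∣_∣; _⊓_; _≤_; _<_; _≤?_; _<?_;
         NonNegative; Positive; nonNegative; positive)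
open import Data.Rational.Properties
  using (module ≤-Reasoning; ≤-refl; ≤-reflexive; ≤-trans; <⇒≤; <-≤-trans; <-irrefl; +-mono-≤; +-monoʳ-≤; +-monoˡ-≤;
         +-mono-≤-<; +-identityʳ; +-inverseʳ; *-monoʳ-≤-nonNeg; *-monoˡ-<-pos;
         neg-antimono-≤; 0≤p⇒∣p∣≡p; ∣-p∣≡∣p∣; p≤q⇒p⊓q≡p; p≥q⇒p⊓q≡q;
         p⊓q≤p; p⊓q≤q; ⊓-sel; nonNeg*nonNeg⇒nonNeg; pos*pos⇒pos; nonNegative⁻¹; positive⁻¹)
open import Data.Rational.Solver using (module +-*-Solver)
open import Function using (case_of_)
open import Data.Sum as Sum using (_⊎_; inj₁; inj₂)
open import Relation.Binary.PropositionalEquality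
open import Relation.Nullary using (Dec; yes; no; contradiction)
open import Relation.Nullary.Decidable using (True; toWitness; from-yes; _×-dec_; _⊎-dec_; _→-dec_)

RatioWitness : ℚ → ℚ → Set
RatioWitness S r =
  Σ (List ℚ) λ I → ValidInput S I ×
    Σ ℚ λ opt → IsOptCost S I opt × (0ℚ < opt) ×
      (∀ (g : List (Fin 3)) → GreedyRun S I g → r * opt ≤ cost S I g)

greedy-forced : ∀ {S ld x xs g rest} j → ld j ℕ.< capacity →
  (∀ k → ld k ℕ.< capacity → k ≡ j ⊎ dist S x (facPos S j) < dist S x (facPos S k)) →
  (∀ {as} → GreedyFrom S (bump ld j) xs as → as ≡ rest) →
  GreedyFrom S ld (x ∷ xs) g → g ≡ j ∷ rest
greedy-forced j avail rivals continue (step {i = i} availᵢ nearest run) with rivals i availᵢ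
... | inj₁ refl = cong (j ∷_) (continue run)
... | inj₂ j<i  = ⊥-elim (<-irrefl refl (<-≤-trans j<i (nearest j avail)))

p≤p+q : ∀ {p q} → 0ℚ ≤ q → p ≤ p + q
p≤p+q {p} {q} 0≤q = subst (_≤ p + q) (+-identityʳ p) (+-monoʳ-≤ p 0≤q)

p≤q⇒0≤q-p : ∀ {p q} → p ≤ q → 0ℚ ≤ q - p
p≤q⇒0≤q-p {p} {q} p≤q = subst (_≤ q - p) (+-inverseʳ p) (+-monoˡ-≤ (- p) p≤q)

0≤* : ∀ {p q} → 0ℚ ≤ p → 0ℚ ≤ q → 0ℚ ≤ p * q
0≤* {p} {q} 0≤p 0≤q = nonNegative⁻¹ (p * q) {{nonNeg*nonNeg⇒nonNeg p {{nonNegative 0≤p}} q {{nonNegative 0≤q}}}}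

0<* : ∀ {p q} → 0ℚ < p → 0ℚ < q → 0ℚ < p * q
0<* {p} {q} 0<p 0<q = positive⁻¹ (p * q) {{pos*pos⇒pos p {{positive 0<p}} q {{positive 0<q}}}}

infixl 6 _⊕_ _⊖_
infixr 7 _⊛_
infix 4 _≤ᶠ_ _<ᶠ_ _≤ᶠ?_ _<ᶠ?_

record Form : Set where
  constructor ⟨_,_⟩
  field
    coefD coefη : ℚ
open Form

0ᶠ ηᶠ : Form
0ᶠ = ⟨ 0ℚ , 0ℚ ⟩
ηᶠ = ⟨ 0ℚ , 1ℚ ⟩

_⊕_ _⊖_ : Form → Form → Form
f ⊕ g = ⟨ coefD f + coefD g , coefη f + coefη g ⟩
f ⊖ g = ⟨ coefD f - coefD g , coefη f - coefη g ⟩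

_⊛_ : ℚ → Form → Form
c ⊛ f = ⟨ c * coefD f , c * coefη f ⟩

⊝_ : Form → Form
⊝ f = ⟨ - coefD f , - coefη f ⟩

_≤ᶠ_ _<ᶠ_ : Form → Form → Set
f ≤ᶠ g = coefD f ≤ coefD g × coefη f ≤ coefη g
f <ᶠ g = coefD f ≤ coefD g × coefη f < coefη g

_≤ᶠ?_ : ∀ f g → Dec (f ≤ᶠ g)
f ≤ᶠ? g = coefD f ≤? coefD g ×-dec coefη f ≤? coefη g

_<ᶠ?_ : ∀ f g → Dec (f <ᶠ g)
f <ᶠ? g = coefD f ≤? coefD g ×-dec coefη f <? coefη g

≤ᶠ-refl : ∀ {f} → f ≤ᶠ f
≤ᶠ-refl = ≤-refl , ≤-refl

≤ᶠ-trans : ∀ {f g h} → f ≤ᶠ g → g ≤ᶠ h → f ≤ᶠ h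
≤ᶠ-trans (d₁ , e₁) (d₂ , e₂) = ≤-trans d₁ d₂ , ≤-trans e₁ e₂

⊕-mono-≤ᶠ : ∀ {f g h k} → f ≤ᶠ g → h ≤ᶠ k → f ⊕ h ≤ᶠ g ⊕ k
⊕-mono-≤ᶠ (d₁ , e₁) (d₂ , e₂) = +-mono-≤ d₁ d₂ , +-mono-≤ e₁ e₂

⊕-monoʳ-≤ᶠ : ∀ h {f g} → f ≤ᶠ g → h ⊕ f ≤ᶠ h ⊕ g
⊕-monoʳ-≤ᶠ h = ⊕-mono-≤ᶠ (≤ᶠ-refl {h})

Comparable : Form → Form → Set
Comparable f g = f ≤ᶠ g ⊎ g ≤ᶠ f

comparable? : ∀ f g → Dec (Comparable f g)
comparable? f g = f ≤ᶠ? g ⊎-dec g ≤ᶠ? f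

minᶠ : Form → Form → Form
minᶠ f g with f ≤ᶠ? g
... | yes _ = f
... | no  _ = g

absᶠ : Form → Form
absᶠ f with 0ᶠ ≤ᶠ? f
... | yes _ = f
... | no  _ = ⊝ f

-- A point of the boundary is represented by the form of its arc-length coordinate.

perimeterᶠ : Form → Form
perimeterᶠ side = fromℕ 3 ⊛ side

facilityᶠ : Form → Fin 3 → Form
facilityᶠ side i = fromℕ (toℕ i) ⊛ side

distᶠ : Form → Form → Form → Form
distᶠ side x y = minᶠ (absᶠ (x ⊖ y)) (perimeterᶠ side ⊖ absᶠ (x ⊖ y))

distTo : Form → Form → Fin 3 → Form
distTo side p i = distᶠ side p (facilityᶠ side i)

DistExact : Form → Form → Form → Set
DistExact side x y =
  Comparable 0ᶠ (x ⊖ y) × Comparable (absᶠ (x ⊖ y)) (perimeterᶠ side ⊖ absᶠ (x ⊖ y))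

distExact? : ∀ side x y → Dec (DistExact side x y)
distExact? side x y = comparable? 0ᶠ (x ⊖ y) ×-dec comparable? _ _

ExactFor : Form → Form → Set
ExactFor side p = ∀ i → DistExact side p (facilityᶠ side i)

exactFor? : ∀ side p → Dec (ExactFor side p)
exactFor? side p = allFin? λ i → distExact? side p (facilityᶠ side i)

costᶠ : Form → List Form → List (Fin 3) → Form
costᶠ side (p ∷ ps) (i ∷ a) = distTo side p i ⊕ costᶠ side ps a
costᶠ side _        _       = 0ᶠ

costᶠ-nonneg : ∀ side {ps} → All (λ p → ∀ i → 0ᶠ ≤ᶠ distTo side p i) ps →
               ∀ a → 0ᶠ ≤ᶠ costᶠ side ps a
costᶠ-nonneg side []       _       = ≤ᶠ-refl
costᶠ-nonneg side (_ ∷ _)  []      = ≤ᶠ-refl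
costᶠ-nonneg side (h ∷ hs) (i ∷ a) = ⊕-mono-≤ᶠ (h i) (costᶠ-nonneg side hs a)

NearestAvailable : Form → Loads → Form → Fin 3 → Set
NearestAvailable side ld p j =
  ld j ℕ.< capacity ×
  (∀ k → ld k ℕ.< capacity → k ≡ j ⊎ distTo side p j <ᶠ distTo side p k)

nearestAvailable? : ∀ side ld p j → Dec (NearestAvailable side ld p j)
nearestAvailable? side ld p j =
  ld j ℕ.<? capacity ×-dec
  allFin? λ k → ld k ℕ.<? capacity →-dec (k ≟ j ⊎-dec distTo side p j <ᶠ? distTo side p k)

module Evaluation (D η : ℚ) (0≤D : 0ℚ ≤ D) (0<η : 0ℚ < η) where
  open +-*-Solver using (solve; _:=_; con; _:+_; _:*_; _:-_; :-_)

  instance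
    D-nonNeg : NonNegative D
    D-nonNeg = nonNegative 0≤D
    η-nonNeg : NonNegative η
    η-nonNeg = nonNegative (<⇒≤ 0<η)
    η-pos : Positive η
    η-pos = positive 0<η

  -- Opaque because unfolding ℚ arithmetic on the unknowns D and η makes type checking blow up.
  opaque
    ⟦_⟧ : Form → ℚ
    ⟦ f ⟧ = coefD f * D + coefη f * η

    ⟦⟧-def : ∀ a b → ⟦ ⟨ a , b ⟩ ⟧ ≡ a * D + b * η
    ⟦⟧-def a b = refl

    ⟦0ᶠ⟧ : ⟦ 0ᶠ ⟧ ≡ 0ℚ
    ⟦0ᶠ⟧ = solve 2 (λ d e → con 0ℚ :* d :+ con 0ℚ :* e := con 0ℚ) refl D η

    ⟦⊕⟧ : ∀ f g → ⟦ f ⊕ g ⟧ ≡ ⟦ f ⟧ + ⟦ g ⟧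
    ⟦⊕⟧ ⟨ a , b ⟩ ⟨ a′ , b′ ⟩ =
      solve 6 (λ a b a′ b′ d e → (a :+ a′) :* d :+ (b :+ b′) :* e := (a :* d :+ b :* e) :+ (a′ :* d :+ b′ :* e))
        refl a b a′ b′ D η

    ⟦⊖⟧ : ∀ f g → ⟦ f ⊖ g ⟧ ≡ ⟦ f ⟧ - ⟦ g ⟧
    ⟦⊖⟧ ⟨ a , b ⟩ ⟨ a′ , b′ ⟩ =
      solve 6 (λ a b a′ b′ d e → (a :- a′) :* d :+ (b :- b′) :* e := (a :* d :+ b :* e) :- (a′ :* d :+ b′ :* e))
        refl a b a′ b′ D η

    ⟦⊛⟧ : ∀ c f → ⟦ c ⊛ f ⟧ ≡ c * ⟦ f ⟧
    ⟦⊛⟧ c ⟨ a , b ⟩ =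
      solve 5 (λ c a b d e → (c :* a) :* d :+ (c :* b) :* e := c :* (a :* d :+ b :* e)) refl c a b D η

    ⟦⊝⟧ : ∀ f → ⟦ ⊝ f ⟧ ≡ - ⟦ f ⟧
    ⟦⊝⟧ ⟨ a , b ⟩ = solve 4 (λ a b d e → (:- a) :* d :+ (:- b) :* e := :- (a :* d :+ b :* e)) refl a b D η

    ⟦⟧-mono-≤ : ∀ {f g} → f ≤ᶠ g → ⟦ f ⟧ ≤ ⟦ g ⟧
    ⟦⟧-mono-≤ (d≤ , e≤) = +-mono-≤ (*-monoʳ-≤-nonNeg D d≤) (*-monoʳ-≤-nonNeg η e≤)

    ⟦⟧-mono-< : ∀ {f g} → f <ᶠ g → ⟦ f ⟧ < ⟦ g ⟧
    ⟦⟧-mono-< (d≤ , e<) = +-mono-≤-< (*-monoʳ-≤-nonNeg D d≤) (*-monoˡ-<-pos η e<)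

  ⟦⟧-nonneg : ∀ {f} → 0ᶠ ≤ᶠ f → 0ℚ ≤ ⟦ f ⟧
  ⟦⟧-nonneg {f} 0≤f = subst (_≤ ⟦ f ⟧) ⟦0ᶠ⟧ (⟦⟧-mono-≤ 0≤f)

  ⟦⟧-pos : ∀ {f} → 0ᶠ <ᶠ f → 0ℚ < ⟦ f ⟧
  ⟦⟧-pos {f} 0<f = subst (_< ⟦ f ⟧) ⟦0ᶠ⟧ (⟦⟧-mono-< 0<f)

  ⟦minᶠ⟧ : ∀ f g → Comparable f g → ⟦ minᶠ f g ⟧ ≡ ⟦ f ⟧ ⊓ ⟦ g ⟧
  ⟦minᶠ⟧ f g cmp with f ≤ᶠ? g | cmp
  ... | yes f≤g | _        = sym (p≤q⇒p⊓q≡p (⟦⟧-mono-≤ f≤g))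
  ... | no  f≰g | inj₁ f≤g = contradiction f≤g f≰g
  ... | no  _   | inj₂ g≤f = sym (p≥q⇒p⊓q≡q (⟦⟧-mono-≤ g≤f))

  ⟦absᶠ⟧ : ∀ f → Comparable 0ᶠ f → ⟦ absᶠ f ⟧ ≡ ∣ ⟦ f ⟧ ∣
  ⟦absᶠ⟧ f sign with 0ᶠ ≤ᶠ? f | sign
  ... | yes 0≤f | _        = sym (0≤p⇒∣p∣≡p (⟦⟧-nonneg 0≤f))
  ... | no  0≰f | inj₁ 0≤f = contradiction 0≤f 0≰f
  ... | no  _   | inj₂ f≤0 = begin
    ⟦ ⊝ f ⟧        ≡⟨ ⟦⊝⟧ f ⟩
    - ⟦ f ⟧        ≡⟨ sym (0≤p⇒∣p∣≡p (neg-antimono-≤ (subst (⟦ f ⟧ ≤_) ⟦0ᶠ⟧ (⟦⟧-mono-≤ f≤0)))) ⟩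
    ∣ - ⟦ f ⟧ ∣    ≡⟨ ∣-p∣≡∣p∣ ⟦ f ⟧ ⟩
    ∣ ⟦ f ⟧ ∣      ∎
    where open ≡-Reasoning

  dist-⟦⟧ : ∀ side x y → DistExact side x y → dist ⟦ side ⟧ ⟦ x ⟧ ⟦ y ⟧ ≡ ⟦ distᶠ side x y ⟧
  dist-⟦⟧ side x y (sign , cmp) = begin
    ∣ ⟦ x ⟧ - ⟦ y ⟧ ∣ ⊓ (perim ⟦ side ⟧ - ∣ ⟦ x ⟧ - ⟦ y ⟧ ∣)
      ≡⟨ cong (λ c → c ⊓ (perim ⟦ side ⟧ - c)) ∣x-y∣≡⟦a⟧ ⟩
    ⟦ a ⟧ ⊓ (perim ⟦ side ⟧ - ⟦ a ⟧)
      ≡⟨ cong (λ c → ⟦ a ⟧ ⊓ (c - ⟦ a ⟧)) (sym (⟦⊛⟧ (fromℕ 3) side)) ⟩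
    ⟦ a ⟧ ⊓ (⟦ perimeterᶠ side ⟧ - ⟦ a ⟧)
      ≡⟨ cong (⟦ a ⟧ ⊓_) (sym (⟦⊖⟧ (perimeterᶠ side) a)) ⟩
    ⟦ a ⟧ ⊓ ⟦ perimeterᶠ side ⊖ a ⟧
      ≡⟨ sym (⟦minᶠ⟧ a (perimeterᶠ side ⊖ a) cmp) ⟩
    ⟦ distᶠ side x y ⟧ ∎
    where
    open ≡-Reasoning
    a : Form
    a = absᶠ (x ⊖ y)
    ∣x-y∣≡⟦a⟧ : ∣ ⟦ x ⟧ - ⟦ y ⟧ ∣ ≡ ⟦ a ⟧
    ∣x-y∣≡⟦a⟧ = trans (cong ∣_∣ (sym (⟦⊖⟧ x y))) (sym (⟦absᶠ⟧ (x ⊖ y) sign))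

  dist-facPos : ∀ side p → ExactFor side p → ∀ i →
                dist ⟦ side ⟧ ⟦ p ⟧ (facPos ⟦ side ⟧ i) ≡ ⟦ distTo side p i ⟧
  dist-facPos side p exact i =
    trans (cong (dist ⟦ side ⟧ ⟦ p ⟧) (sym (⟦⊛⟧ (fromℕ (toℕ i)) side)))
          (dist-⟦⟧ side p (facilityᶠ side i) (exact i))

  cost-⟦⟧ : ∀ side {ps} → All (ExactFor side) ps →
            ∀ a → cost ⟦ side ⟧ (map ⟦_⟧ ps) a ≡ ⟦ costᶠ side ps a ⟧
  cost-⟦⟧ side []                _       = sym ⟦0ᶠ⟧
  cost-⟦⟧ side (_ ∷ _)           []      = sym ⟦0ᶠ⟧
  cost-⟦⟧ side {p ∷ ps} (e ∷ es) (i ∷ a) =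
    trans (cong₂ _+_ (dist-facPos side p e i) (cost-⟦⟧ side es a))
          (sym (⟦⊕⟧ (distTo side p i) (costᶠ side ps a)))

  greedy-forcedᶠ : ∀ side {ld xs g rest} p j → ExactFor side p → NearestAvailable side ld p j →
    (∀ {as} → GreedyFrom ⟦ side ⟧ (bump ld j) xs as → as ≡ rest) →
    GreedyFrom ⟦ side ⟧ ld (⟦ p ⟧ ∷ xs) g → g ≡ j ∷ rest
  greedy-forcedᶠ side p j exact (avail , rivals) =
    greedy-forced j avail λ k availₖ → Sum.map₂ (strictly k) (rivals k availₖ)
    where
    strictly : ∀ k → distTo side p j <ᶠ distTo side p k →
               dist ⟦ side ⟧ ⟦ p ⟧ (facPos ⟦ side ⟧ j) < dist ⟦ side ⟧ ⟦ p ⟧ (facPos ⟦ side ⟧ k)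
    strictly k lt = subst₂ _<_ (sym (dist-facPos side p exact j)) (sym (dist-facPos side p exact k))
                           (⟦⟧-mono-< lt)

side : Form
side = ⟨ 1ℚ , fromℕ 24 ⟩

vertex : Fin 3 → Form
vertex = facilityᶠ side

one two : Fin 3
one = suc zero
two = suc (suc zero)

justBeforeMidpoint justBeforeVertex₀ : Form
justBeforeMidpoint = (+ 1 / 2) ⊛ side ⊖ ηᶠ
justBeforeVertex₀  = perimeterᶠ side ⊖ ηᶠ

front back customers : List Form
front = justBeforeMidpoint ∷ vertex zero ∷ justBeforeVertex₀ ∷ []
back = vertex two ∷ vertex two ∷ vertex one ∷ []
customers = front ++ back

greedyAssignment optimalAssignment : List (Fin 3)
greedyAssignment  = zero ∷ zero ∷ two ∷ two ∷ one ∷ one ∷ []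
optimalAssignment = one ∷ zero ∷ zero ∷ two ∷ two ∷ one ∷ []

greedyCostᶠ optimalCostᶠ : Form
greedyCostᶠ   = ⟨ + 5 / 2 , fromℕ 58 ⟩
optimalCostᶠ = ⟨ + 1 / 2 , fromℕ 14 ⟩

customers-exact : All (ExactFor side) customers
customers-exact = from-yes (All.all? (exactFor? side) customers)

customers-inside : All (λ p → 0ᶠ ≤ᶠ p × p <ᶠ perimeterᶠ side) customers
customers-inside = from-yes (All.all? (λ p → 0ᶠ ≤ᶠ? p ×-dec p <ᶠ? perimeterᶠ side) customers)

optimalAssignment-within-capacity : ∀ i → load optimalAssignment i ℕ.≤ capacity
optimalAssignment-within-capacity = from-yes (allFin? λ i → load optimalAssignment i ℕ.≤? capacity)

-- Checked over all 27 choices: unless the first three customers all go to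
-- vertex 0 (over capacity), they alone already cost at least the optimum.
front-lower : ∀ i₁ i₂ i₃ →
  (i₁ ≡ zero × i₂ ≡ zero × i₃ ≡ zero) ⊎ optimalCostᶠ ≤ᶠ costᶠ side front (i₁ ∷ i₂ ∷ i₃ ∷ [])
front-lower = from-yes (allFin? λ i₁ → allFin? λ i₂ → allFin? λ i₃ →
  (i₁ ≟ zero ×-dec i₂ ≟ zero ×-dec i₃ ≟ zero) ⊎-dec
  optimalCostᶠ ≤ᶠ? costᶠ side front (i₁ ∷ i₂ ∷ i₃ ∷ []))

back-nonneg : All (λ p → ∀ i → 0ᶠ ≤ᶠ distTo side p i) back
back-nonneg = from-yes (All.all? (λ p → allFin? λ i → 0ᶠ ≤ᶠ? distTo side p i) back)

costᶠ-prefix-≤ : ∀ side ps qs a b → length ps ≡ length a → 0ᶠ ≤ᶠ costᶠ side qs b →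
             costᶠ side ps a ≤ᶠ costᶠ side (ps ++ qs) (a ++ b)
costᶠ-prefix-≤ side []       qs []      b _   0≤rest = 0≤rest
costᶠ-prefix-≤ side (p ∷ ps) qs (i ∷ a) b len 0≤rest =
  ⊕-monoʳ-≤ᶠ (distTo side p i) (costᶠ-prefix-≤ side ps qs a b (ℕ.suc-injective len) 0≤rest)

module Construction (D η : ℚ) (0≤D : 0ℚ ≤ D) (0<η : 0ℚ < η) where
  open Evaluation D η 0≤D 0<η
  open +-*-Solver using (solve; _:=_; con; _:+_; _:*_; _:-_)

  S : ℚ
  S = ⟦ side ⟧

  I : List ℚ
  I = map ⟦_⟧ customers

  valid : ValidInput S I
  valid = ℕ.≤-refl , map⁺ (All.map inside customers-inside)
    where
    inside : ∀ {p} → 0ᶠ ≤ᶠ p × p <ᶠ perimeterᶠ side → OnBoundary S ⟦ p ⟧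
    inside {p} (0≤p , p<3S) = ⟦⟧-nonneg 0≤p , subst (⟦ p ⟧ <_) (⟦⊛⟧ (fromℕ 3) side) (⟦⟧-mono-< p<3S)

  optimal-lowerᶠ : ∀ b → Feasible I b → optimalCostᶠ ≤ᶠ costᶠ side customers b
  optimal-lowerᶠ (i₁ ∷ i₂ ∷ i₃ ∷ rest) (_ , loads) =
    Sum.[ (λ { (refl , refl , refl) → contradiction (loads zero) λ { (s≤s (s≤s ())) } })
        , (λ bound → ≤ᶠ-trans bound (costᶠ-prefix-≤ side front back (i₁ ∷ i₂ ∷ i₃ ∷ []) rest refl
                                                (costᶠ-nonneg side back-nonneg rest)))
        ]′ (front-lower i₁ i₂ i₃)
  optimal-lowerᶠ []              (() , _)
  optimal-lowerᶠ (_ ∷ [])        (() , _)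
  optimal-lowerᶠ (_ ∷ _ ∷ [])    (() , _)

  optimal : IsOptCost S I ⟦ optimalCostᶠ ⟧
  optimal = (optimalAssignment , (refl , optimalAssignment-within-capacity)
                               , cost-⟦⟧ side customers-exact optimalAssignment)
          , λ b feasible → subst (⟦ optimalCostᶠ ⟧ ≤_) (sym (cost-⟦⟧ side customers-exact b))
                                 (⟦⟧-mono-≤ (optimal-lowerᶠ b feasible))

  forced : ∀ {ld xs g rest} p j {_ : True (exactFor? side p)} {_ : True (nearestAvailable? side ld p j)} →
    (∀ {as} → GreedyFrom S (bump ld j) xs as → as ≡ rest) →
    GreedyFrom S ld (⟦ p ⟧ ∷ xs) g → g ≡ j ∷ rest
  forced p j {exact} {nearest} = greedy-forcedᶠ side p j (toWitness exact) (toWitness nearest)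

  greedy-run : ∀ {g} → GreedyRun S I g → g ≡ greedyAssignment
  greedy-run =
    forced justBeforeMidpoint zero (forced (vertex zero) zero
      (forced justBeforeVertex₀ two (forced (vertex two) two
        (forced (vertex two) one (forced (vertex one) one λ { done → refl })))))

  greedy-cost : ∀ {g} → GreedyRun S I g → cost S I g ≡ ⟦ greedyCostᶠ ⟧
  greedy-cost run = trans (cong (cost S I) (greedy-run run)) (cost-⟦⟧ side customers-exact greedyAssignment)

  S≡D+24η : S ≡ 1ℚ * D + fromℕ 24 * η
  S≡D+24η = ⟦⟧-def 1ℚ (fromℕ 24)

  greedy-vs-optimal : ∀ ε → 0ℚ ≤ ε → fromℕ 24 * η ≤ ε * S →
                      (fromℕ 5 - ε) * ⟦ optimalCostᶠ ⟧ ≤ ⟦ greedyCostᶠ ⟧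
  greedy-vs-optimal ε 0≤ε 24η≤εS = begin
    (fromℕ 5 - ε) * ⟦ optimalCostᶠ ⟧          ≤⟨ p≤p+q slack≥0 ⟩
    (fromℕ 5 - ε) * ⟦ optimalCostᶠ ⟧ + slack  ≡⟨ cong₂ (λ o s → (fromℕ 5 - ε) * o + slackOf s)
                                                       (⟦⟧-def half (fromℕ 14)) S≡D+24η ⟩
    (fromℕ 5 - ε) * (half * D + fromℕ 14 * η) + slackOf (1ℚ * D + fromℕ 24 * η)
                                              ≡⟨ solve 3 (λ d e x →
                                                   (con (fromℕ 5) :- x) :* (con half :* d :+ con (fromℕ 14) :* e)
                                                   :+ (con half :* (x :* (con 1ℚ :* d :+ con (fromℕ 24) :* e)
                                                                    :- con (fromℕ 24) :* e)
                                                       :+ con (fromℕ 2) :* (x :* e))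
                                                   := con (+ 5 / 2) :* d :+ con (fromℕ 58) :* e)
                                                 refl D η ε ⟩
    (+ 5 / 2) * D + fromℕ 58 * η              ≡⟨ sym (⟦⟧-def (+ 5 / 2) (fromℕ 58)) ⟩
    ⟦ greedyCostᶠ ⟧                            ∎
    where
    open ≤-Reasoning
    half : ℚ
    half = + 1 / 2
    slackOf : ℚ → ℚ
    slackOf s = half * (ε * s - fromℕ 24 * η) + fromℕ 2 * (ε * η)
    slack : ℚ
    slack = slackOf S
    slack≥0 : 0ℚ ≤ slack
    slack≥0 = +-mono-≤ (0≤* (from-yes (0ℚ ≤? half)) (p≤q⇒0≤q-p 24η≤εS))
                       (0≤* (from-yes (0ℚ ≤? fromℕ 2)) (0≤* 0≤ε (<⇒≤ 0<η)))

  ratio : ∀ ε → 0ℚ ≤ ε → fromℕ 24 * η ≤ ε * S → RatioWitness S (fromℕ 5 - ε)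
  ratio ε 0≤ε 24η≤εS =
    I , valid , ⟦ optimalCostᶠ ⟧ , optimal , ⟦⟧-pos (from-yes (0ᶠ <ᶠ? optimalCostᶠ)) ,
    λ g run → subst ((fromℕ 5 - ε) * ⟦ optimalCostᶠ ⟧ ≤_) (sym (greedy-cost run)) (greedy-vs-optimal ε 0≤ε 24η≤εS)

split-side : ∀ S ε → 0ℚ < S → 0ℚ < ε →
  Σ ℚ λ D → Σ ℚ λ η → 0ℚ ≤ D × 0ℚ < η × S ≡ 1ℚ * D + fromℕ 24 * η × fromℕ 24 * η ≤ ε * S
split-side S ε 0<S 0<ε = D , η , 0≤D , 0<η , S≡D+24η , 24η≤εS
  where
  open +-*-Solver using (solve; _:=_; con; _:+_; _:*_; _:-_)
  m D η : ℚ
  m = ε ⊓ 1ℚ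
  D = (1ℚ - m) * S
  η = + 1 / 24 * (m * S)

  0<m : 0ℚ < m
  0<m = Sum.[ (λ m≡ε → subst (0ℚ <_) (sym m≡ε) 0<ε) , (λ m≡1 → subst (0ℚ <_) (sym m≡1) (from-yes (0ℚ <? 1ℚ))) ]′
          (⊓-sel ε 1ℚ)

  0≤D : 0ℚ ≤ D
  0≤D = 0≤* (p≤q⇒0≤q-p (p⊓q≤q ε 1ℚ)) (<⇒≤ 0<S)

  0<η : 0ℚ < η
  0<η = 0<* (from-yes (0ℚ <? + 1 / 24)) (0<* 0<m 0<S)

  24η≡mS : fromℕ 24 * η ≡ m * S
  24η≡mS = solve 2 (λ m s → con (fromℕ 24) :* (con (+ 1 / 24) :* (m :* s)) := m :* s) refl m S

  S≡D+24η : S ≡ 1ℚ * D + fromℕ 24 * η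
  S≡D+24η = trans (solve 2 (λ m s → s := con 1ℚ :* ((con 1ℚ :- m) :* s) :+ m :* s) refl m S)
                  (cong (λ t → 1ℚ * D + t) (sym 24η≡mS))

  24η≤εS : fromℕ 24 * η ≤ ε * S
  24η≤εS = ≤-trans (≤-reflexive 24η≡mS) (*-monoʳ-≤-nonNeg S {{nonNegative (<⇒≤ 0<S)}} (p⊓q≤p ε 1ℚ))

mainTheorem2 : ∀ (S : ℚ) → 0ℚ < S →
    ∀ (ε : ℚ) → 0ℚ < ε →
    Σ (List ℚ) λ I → ValidInput S I ×
      Σ ℚ λ opt → IsOptCost S I opt × (0ℚ < opt) ×
        (∀ (g : List (Fin 3)) → GreedyRun S I g → (fromℕ 5 - ε) * opt ≤ cost S I g)
mainTheorem2 S 0<S ε 0<ε = case split-side S ε 0<S 0<ε of λ where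
  (D , η , 0≤D , 0<η , S≡D+24η , 24η≤εS) →
    let open Construction D η 0≤D 0<η using (ratio) renaming (S to S₀; S≡D+24η to S₀≡D+24η)
        S≡S₀ = trans S≡D+24η (sym S₀≡D+24η)
    in subst (λ T → RatioWitness T (fromℕ 5 - ε)) (sym S≡S₀)
             (ratio ε (<⇒≤ 0<ε) (subst (λ T → fromℕ 24 * η ≤ ε * T) S≡S₀ 24η≤εS))
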